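{- Let $\mathbb{A}=(Q,\Sigma,\circ_l,\circ_r)$ be a two-way automaton, let $x\in\Sigma$, let $Q_l$ and $Q_r$ be the sets of left-moving and right-moving states, and let $j=t_r(x)$, $k=t_l(x)$. Then, computing with $2\times 2$ matrices of relations on $Q$, $$\begin{pmatrix}[\leftarrow x-] & [\rightleftharpoons x]\\ [x\rightleftharpoons] & [-x\rightarrow]\end{pmatrix}=\begin{pmatrix}1_{Q_l}&0\\0&1_{Q_r}\end{pmatrix}\begin{pmatrix}k&0\\0&j\end{pmatrix}\left[\begin{pmatrix}0&1\\1&0\end{pmatrix}\begin{pmatrix}k&0\\0&j\end{pmatrix}\right]^*\begin{pmatrix}1_{Q_l}&0\\0&1_{Q_r}\end{pmatrix}.$$
   Context: Relations on $Q$ are subsets of $Q\times Q$; composite $SR=\{(c,a):\exists b,(c,b)\in S,(b,a)\in R\}$; $1$ is the identity relation on $Q$, $0$ the empty relation, $1_A=\{(a,a):a\in A\}$. Matrices of relations are multiplied as usual with product of entries given by composition and sum given by union; for a matrix $M$, $M^*=\bigcup_{k\ge0}M^k$ with $M^0$ the identity matrix. A two-way automaton has finite state set $Q$, finite alphabet $\Sigma$, and functions $\circ_l:\Sigma\times Q\to P(Q)$, $\circ_r:Q\times\Sigma\to P(Q)$. $Q_l=\{q: y\circ_l q\ne\emptyset\text{ for some }y\in\Sigma\}$, $Q_r=\{q: q\circ_r y\ne\emptyset\text{ for some }y\}$. $t_l(x)=\{(b,a): b\in x\circ_l a\}$ and $t_r(x)=\{(b,a): b\in a\circ_r x\}$.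 A configuration on a word $x_1\cdots x_n$ is a pointer position $i\in\{0,\dots,n\}$ with a state; a step goes from position $i\ge1$, state $a$, to position $i-1$, state $b\in x_i\circ_l a$, or from position $i<n$, state $a$, to position $i+1$, state $c\in a\circ_r x_{i+1}$. A computation is a finite sequence of one or more steps. For a word $w$ of length $n$: $[\rightleftharpoons w]=\{(q',q)\}$ with a computation from position $0$, state $q$ to position $0$, state $q'$, where $q\in Q_r,q'\in Q_l$; $[-w\rightarrow]$: from position $0$ to position $n$, $q,q'\in Q_r$; $[\leftarrow w-]$: from position $n$ to position $0$, $q,q'\in Q_l$; $[w\rightleftharpoons]$: from position $n$ to position $n$, $q\in Q_l$, $q'\in Q_r$. -}

module Defs where

open import Data.Nat using (ℕ; zero; suc; _<_)
open import Data.Fin using (Fin; zero; suc; fromℕ<)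
open import Data.Fin.Subset using (Subset; _∈_; Nonempty)
open import Data.List using (List; length; lookup; [_])
open import Data.Product using (_×_; _,_; ∃; ∃-syntax)
open import Data.Sum using (_⊎_)
open import Data.Empty using (⊥)
open import Relation.Binary.PropositionalEquality using (_≡_)
open import Relation.Binary.Construct.Closure.Transitive using (TransClosure)
open import Function.Bundles using (_⇔_)

-- A two-way automaton with finite state set Q = Fin n and finite alphabet Σ = Fin m.
-- ∘l y a  is  y ∘_l a ⊆ Q ;  ∘r a y  is  a ∘_r y ⊆ Q.
record TwoWay (n m : ℕ) : Set where
  field
    ∘l : Fin m → Fin n → Subset n
    ∘r : Fin n → Fin m → Subset n

-- Relations on Q: R c a means (c , a) ∈ R.
Relation : ℕ → Set₁
Relation n = Fin n → Fin n → Set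

_⊙_ : ∀ {n} → Relation n → Relation n → Relation n
(S ⊙ R) c a = ∃[ b ] (S c b × R b a)

_∪_ : ∀ {n} → Relation n → Relation n → Relation n
(S ∪ R) c a = S c a ⊎ R c a

𝟙 : ∀ {n} → Relation n
𝟙 c a = c ≡ a

𝟘 : ∀ {n} → Relation n
𝟘 c a = ⊥

𝟙[_] : ∀ {n} → (Fin n → Set) → Relation n
𝟙[ A ] c a = c ≡ a × A a

Mat : ℕ → Set₁
Mat n = Fin 2 → Fin 2 → Relation n

mat : ∀ {n} → Relation n → Relation n → Relation n → Relation n → Mat n
mat a b c d zero zero = a
mat a b c d zero (suc zero) = b
mat a b c d (suc zero) zero = c
mat a b c d (suc zero) (suc zero) = d

_⊗_ : ∀ {n} → Mat n → Mat n → Mat n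
(M ⊗ N) i k = (M i zero ⊙ N zero k) ∪ (M i (suc zero) ⊙ N (suc zero) k)

I : ∀ {n} → Mat n
I = mat 𝟙 𝟘 𝟘 𝟙

_^_ : ∀ {n} → Mat n → ℕ → Mat n
M ^ zero = I
M ^ suc k = (M ^ k) ⊗ M

_⋆ : ∀ {n} → Mat n → Mat n
(M ⋆) i j c a = ∃[ k ] ((M ^ k) i j c a)

_≋_ : ∀ {n} → Mat n → Mat n → Set
M ≋ N = ∀ i j c a → (M i j c a ⇔ N i j c a)

module _ {n m : ℕ} (A : TwoWay n m) where
  open TwoWay A

  Ql : Fin n → Set
  Ql q = ∃[ y ] Nonempty (∘l y q)

  Qr : Fin n → Set
  Qr q = ∃[ y ] Nonempty (∘r q y)

  tl : Fin m → Relation n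
  tl x b a = b ∈ ∘l x a

  tr : Fin m → Relation n
  tr x b a = b ∈ ∘r a x

  Config : Set
  Config = ℕ × Fin n

  -- one step of computation on word w = x_1 ⋯ x_len (x_{i+1} = lookup w i)
  data Step (w : List (Fin m)) : Config → Config → Set where
    left  : ∀ {i a b} (h : i < length w) → b ∈ ∘l (lookup w (fromℕ< h)) a →
            Step w (suc i , a) (i , b)
    right : ∀ {i a c} (h : i < length w) → c ∈ ∘r a (lookup w (fromℕ< h)) →
            Step w (i , a) (suc i , c)

  Comp : List (Fin m) → Config → Config → Set
  Comp w = TransClosure (Step w)

  LoopL : List (Fin m) → Relation n
  LoopL w q′ q = Qr q × Ql q′ × Comp w (0 , q) (0 , q′)

  Right : List (Fin m) → Relation n
  Right w q′ q = Qr q × Qr q′ × Comp w (0 , q) (length w , q′)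

  Left : List (Fin m) → Relation n
  Left w q′ q = Ql q × Ql q′ × Comp w (length w , q) (0 , q′)

  LoopR : List (Fin m) → Relation n
  LoopR w q′ q = Ql q × Qr q′ × Comp w (length w , q) (length w , q′)

-- On a one-letter word the pointer sits at position 0 or 1, and every step is either a
-- k-step from 1 to 0 or a j-step from 0 to 1. Labelling a configuration by the index of the
-- move it has to make next, S ⊗ K is the one-step relation between labelled configurations,
-- so a computation is a power of S ⊗ K followed by a final K-step. The outer diagonal
-- factors impose the Q_l / Q_r conditions on the two end states.
module Submission where

open import Level using (0ℓ)
open import Defs
open import Data.Nat using (ℕ; zero; suc; z≤n; s≤s)
open import Data.Fin using (Fin; zero; suc)
open import Data.List using ([_])
open import Data.Product using (_×_; _,_; ∃-syntax)
open import Data.Product.Function.NonDependent.Propositional using (_×-⇔_)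
open import Data.Sum using (inj₁; inj₂)
open import Relation.Binary.PropositionalEquality using (_≡_; refl)
open import Relation.Binary.Construct.Closure.Transitive using (_∷_) renaming ([_] to ⟪_⟫)
open import Function.Bundles using (_⇔_; mk⇔)
open import Function.Properties.Equivalence using (⇔-setoid)
open import Function.Construct.Identity using (⇔-id)
open import Relation.Binary.Reasoning.Setoid (⇔-setoid 0ℓ)

⊗⇔∃ : ∀ {n} (M N : Mat n) i k c a →
      (M ⊗ N) i k c a ⇔ (∃[ l ] ∃[ b ] (M i l c b × N l k b a))
⊗⇔∃ M N i k c a = mk⇔
  (λ { (inj₁ (b , p , q)) → zero , b , p , q ; (inj₂ (b , p , q)) → suc zero , b , p , q })
  (λ { (zero , b , p , q) → inj₁ (b , p , q) ; (suc zero , b , p , q) → inj₂ (b , p , q) })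

I-refl : ∀ {n} i {a : Fin n} → I i i a a
I-refl zero       = refl
I-refl (suc zero) = refl

I-diagonal : ∀ {n} {i k} {c a : Fin n} → I i k c a → i ≡ k × c ≡ a
I-diagonal {i = zero}     {zero}     refl = refl , refl
I-diagonal {i = suc zero} {suc zero} refl = refl , refl
I-diagonal {i = zero}     {suc zero} ()
I-diagonal {i = suc zero} {zero}     ()

^-snoc : ∀ {n} (M : Mat n) t l {i k c b a} → (M ^ t) i l c b → M l k b a → (M ^ suc t) i k c a
^-snoc M t zero       p q = inj₁ (_ , p , q)
^-snoc M t (suc zero) p q = inj₂ (_ , p , q)

⊗-assoc : ∀ {n} (L M N : Mat n) i k c a → ((L ⊗ M) ⊗ N) i k c a ⇔ (L ⊗ (M ⊗ N)) i k c a
⊗-assoc L M N i k c a = mk⇔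
  (λ { (inj₁ (b , inj₁ (d , p , q) , r)) → inj₁ (d , p , inj₁ (b , q , r))
     ; (inj₁ (b , inj₂ (d , p , q) , r)) → inj₂ (d , p , inj₁ (b , q , r))
     ; (inj₂ (b , inj₁ (d , p , q) , r)) → inj₁ (d , p , inj₂ (b , q , r))
     ; (inj₂ (b , inj₂ (d , p , q) , r)) → inj₂ (d , p , inj₂ (b , q , r)) })
  (λ { (inj₁ (d , p , inj₁ (b , q , r))) → inj₁ (b , inj₁ (d , p , q) , r)
     ; (inj₂ (d , p , inj₁ (b , q , r))) → inj₁ (b , inj₂ (d , p , q) , r)
     ; (inj₁ (d , p , inj₂ (b , q , r))) → inj₂ (b , inj₁ (d , p , q) , r)
     ; (inj₂ (d , p , inj₂ (b , q , r))) → inj₂ (b , inj₂ (d , p , q) , r) })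

module _ {n} (P Q : Fin n → Set) where

  diagonal : Mat n
  diagonal = mat 𝟙[ P ] 𝟘 𝟘 𝟙[ Q ]

  guard : Fin 2 → Fin n → Set
  guard zero       = P
  guard (suc zero) = Q

  diagonal-⊗ : ∀ (X : Mat n) i k c a → (diagonal ⊗ X) i k c a ⇔ (guard i c × X i k c a)
  diagonal-⊗ X zero k c a = mk⇔
    (λ { (inj₁ (_ , (refl , p) , x)) → p , x ; (inj₂ (_ , () , _)) })
    (λ { (p , x) → inj₁ (c , (refl , p) , x) })
  diagonal-⊗ X (suc zero) k c a = mk⇔
    (λ { (inj₂ (_ , (refl , q) , x)) → q , x ; (inj₁ (_ , () , _)) })
    (λ { (q , x) → inj₂ (c , (refl , q) , x) })

  ⊗-diagonal : ∀ (X : Mat n) i k c a → (X ⊗ diagonal) i k c a ⇔ (X i k c a × guard k a)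
  ⊗-diagonal X i zero c a = mk⇔
    (λ { (inj₁ (_ , x , (refl , p))) → x , p ; (inj₂ (_ , _ , ())) })
    (λ { (x , p) → inj₁ (a , x , (refl , p)) })
  ⊗-diagonal X i (suc zero) c a = mk⇔
    (λ { (inj₂ (_ , x , (refl , q))) → x , q ; (inj₁ (_ , _ , ())) })
    (λ { (x , q) → inj₂ (a , x , (refl , q)) })

reassoc : ∀ {P Q R : Set} → (P × Q × R) ⇔ ((Q × R) × P)
reassoc = mk⇔ (λ (p , q , r) → (q , r) , p) (λ ((q , r) , p) → p , q , r)

module OneLetter {n m : ℕ} (A : TwoWay n m) (x : Fin m) where

  D K S M : Mat n
  D = diagonal (Ql A) (Qr A)
  K = mat (tl A x) 𝟘 𝟘 (tr A x)
  S = mat 𝟘 𝟙 𝟙 𝟘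
  M = S ⊗ K

  moving : Fin 2 → Fin n → Set
  moving = guard (Ql A) (Qr A)

  Run : Config A → Config A → Set
  Run = Comp A [ x ]

  -- Index zero stands for the left-moving part (k, moves from position 1 to 0),
  -- index one for the right-moving part (j, moves from position 0 to 1).
  source target : Fin 2 → ℕ
  source zero       = 1
  source (suc zero) = 0
  target zero       = 0
  target (suc zero) = 1

  step⇒K : ∀ {p a q c} i i′ → Step A [ x ] (p , a) (q , c) →
           p ≡ source i → q ≡ target i′ → K i′ i c a
  step⇒K zero       zero       (left  (s≤s z≤n) b∈) refl refl = b∈
  step⇒K (suc zero) (suc zero) (right (s≤s z≤n) c∈) refl refl = c∈
  step⇒K (suc zero) _ (left  _ _) () _
  step⇒K zero       _ (right (s≤s ()) _) refl _
  step⇒K zero       (suc zero) (left  (s≤s z≤n) _) refl ()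
  step⇒K (suc zero) zero       (right (s≤s z≤n) _) refl ()

  K⇒step : ∀ i i′ {c a} → K i′ i c a → Step A [ x ] (source i , a) (target i′ , c)
  K⇒step zero       zero       b∈ = left  (s≤s z≤n) b∈
  K⇒step (suc zero) (suc zero) c∈ = right (s≤s z≤n) c∈
  K⇒step zero       (suc zero) ()
  K⇒step (suc zero) zero       ()

  -- M = S ⊗ K relabels the target of a K-step as the source index it lands on.
  step⇒M : ∀ {p a q c} i → Step A [ x ] (p , a) (q , c) →
           p ≡ source i → ∃[ l ] (q ≡ source l × M l i c a)
  step⇒M zero       (left  (s≤s z≤n) b∈) refl = suc zero , refl , inj₁ (_ , refl , b∈)
  step⇒M (suc zero) (right (s≤s z≤n) c∈) refl = zero , refl , inj₂ (_ , refl , c∈)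
  step⇒M (suc zero) (left  _ _) ()
  step⇒M zero       (right (s≤s ()) _) refl

  M⇒step : ∀ l i {c a} → M l i c a → Step A [ x ] (source i , a) (source l , c)
  M⇒step zero       i (inj₂ (_ , refl , k)) = K⇒step i (suc zero) k
  M⇒step (suc zero) i (inj₁ (_ , refl , k)) = K⇒step i zero k

  run⇒M⋆-then-K : ∀ {p a q c} i i′ → Run (p , a) (q , c) → p ≡ source i → q ≡ target i′ →
             ∃[ l ] ∃[ b ] (K i′ l c b × (M ⋆) l i b a)
  run⇒M⋆-then-K i i′ ⟪ s ⟫ p≡ q≡ = i , _ , step⇒K i i′ s p≡ q≡ , 0 , I-refl i
  run⇒M⋆-then-K i i′ (s ∷ r) p≡ q≡ with step⇒M i s p≡
  ... | l , p′≡ , mm with run⇒M⋆-then-K l i′ r p′≡ q≡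
  ...   | l′ , b , k , t , mt = l′ , b , k , suc t , ^-snoc M t l {k = i} mt mm

  M^⇒run : ∀ t {l i b a z} → (M ^ t) l i b a → Run (source l , b) z → Run (source i , a) z
  M^⇒run zero {l} {i} mt r with I-diagonal {i = l} {i} mt
  ... | refl , refl = r
  M^⇒run (suc t) (inj₁ (_ , mt , mm)) r = M⇒step zero _ mm ∷ M^⇒run t mt r
  M^⇒run (suc t) (inj₂ (_ , mt , mm)) r = M⇒step (suc zero) _ mm ∷ M^⇒run t mt r

  run⇔M⋆-then-K : ∀ i′ i c a →
             Run (source i , a) (target i′ , c) ⇔ (∃[ l ] ∃[ b ] (K i′ l c b × (M ⋆) l i b a))
  run⇔M⋆-then-K i′ i c a = mk⇔ (λ r → run⇒M⋆-then-K i i′ r refl refl)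
    (λ { (l , b , k , t , mt) → M^⇒run t mt ⟪ K⇒step l i′ k ⟫ })

  boundary : ∀ i′ i c a →
             mat (Left A [ x ]) (LoopL A [ x ]) (LoopR A [ x ]) (Right A [ x ]) i′ i c a ⇔
             ((moving i′ c × Run (source i , a) (target i′ , c)) × moving i a)
  boundary zero       zero       c a = reassoc
  boundary zero       (suc zero) c a = reassoc
  boundary (suc zero) zero       c a = reassoc
  boundary (suc zero) (suc zero) c a = reassoc

theorem3 : ∀ {n m : ℕ} (A : TwoWay n m) (x : Fin m) →
    let j = tr A x
        k = tl A x
        D = mat 𝟙[ Ql A ] 𝟘 𝟘 𝟙[ Qr A ]
        K = mat k 𝟘 𝟘 j
        S = mat 𝟘 𝟙 𝟙 𝟘
    in mat (Left A [ x ]) (LoopL A [ x ]) (LoopR A [ x ]) (Right A [ x ])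
         ≋ (((D ⊗ K) ⊗ ((S ⊗ K) ⋆)) ⊗ D)
theorem3 A x i′ i c a = begin
  mat (Left A [ x ]) (LoopL A [ x ]) (LoopR A [ x ]) (Right A [ x ]) i′ i c a
    ≈⟨ boundary i′ i c a ⟩
  ((moving i′ c × Run (source i , a) (target i′ , c)) × moving i a)
    ≈⟨ (⇔-id _ ×-⇔ run⇔M⋆-then-K i′ i c a) ×-⇔ ⇔-id _ ⟩
  ((moving i′ c × ∃[ l ] ∃[ b ] (K i′ l c b × (M ⋆) l i b a)) × moving i a)
    ≈⟨ (⇔-id _ ×-⇔ ⊗⇔∃ K (M ⋆) i′ i c a) ×-⇔ ⇔-id _ ⟨
  ((moving i′ c × (K ⊗ (M ⋆)) i′ i c a) × moving i a)
    ≈⟨ diagonal-⊗ (Ql A) (Qr A) (K ⊗ (M ⋆)) i′ i c a ×-⇔ ⇔-id _ ⟨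
  ((D ⊗ (K ⊗ (M ⋆))) i′ i c a × moving i a)
    ≈⟨ ⊗-assoc D K (M ⋆) i′ i c a ×-⇔ ⇔-id _ ⟨
  (((D ⊗ K) ⊗ (M ⋆)) i′ i c a × moving i a)
    ≈⟨ ⊗-diagonal (Ql A) (Qr A) ((D ⊗ K) ⊗ (M ⋆)) i′ i c a ⟨
  (((D ⊗ K) ⊗ (M ⋆)) ⊗ D) i′ i c a ∎
  where open OneLetter A x
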